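{- Let $\mathcal{I}$ and $\mathcal{J}$ be isomorphic sharp interval systems. For every hypergraph isomorphism $\psi$ from $\mathcal{I}$ to $\mathcal{J}$ there is a hypergraph isomorphism $\psi'$ from $\mathcal{I}$ to $\mathcal{J}$ such that $\psi'(A)=\psi(A)$ for all $A\in\mathcal{I}$ and $\psi'$ maps the extreme points of each interval $A\in\mathcal{I}$ to the extreme points of the interval $\psi(A)\in\mathcal{J}$.
   Context: An interval system is a hypergraph whose vertex set is a set of consecutive integers $\{1,\dots,N\}$ and whose hyperedges are intervals $[a,b]=\{a,a+1,\dots,b\}$ of integers; $a$ and $b$ are the extreme points (start and end point) of $[a,b]$. An interval system with $m$ intervals on $\{1,\dots,2m\}$ is sharp if all extreme points of its intervals are pairwise distinct (every point is the start or end point of exactly one interval). A hypergraph isomorphism is a bijection of vertex sets mapping hyperedges exactly onto hyperedges. -}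

module Defs where

open import Data.Nat using (ℕ; _*_)
open import Data.Fin using (Fin; _≤_)
open import Data.Sum using (_⊎_; inj₁; inj₂)
open import Data.Product using (_×_; _,_; ∃)
open import Relation.Binary.PropositionalEquality using (_≡_)
open import Function.Bundles using (_↔_; Inverse; _⇔_)
open import Function.Definitions using (Injective)

-- Vertex set {1,…,2m} is represented by Fin (2 * m) (i.e. shifted to {0,…,2m-1}).
-- An interval system with m intervals: interval i is [start i , end i].
record IntervalSystem (m : ℕ) : Set where
  field
    start     : Fin m → Fin (2 * m)
    end       : Fin m → Fin (2 * m)
    start≤end : ∀ i → start i ≤ end i
open IntervalSystem public

_∈I_ : ∀ {m} → Fin (2 * m) → IntervalSystem m × Fin m → Set
v ∈I (I , i) = (start I i ≤ v) × (v ≤ end I i)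

extreme : ∀ {m} → IntervalSystem m → Fin m ⊎ Fin m → Fin (2 * m)
extreme I (inj₁ i) = start I i
extreme I (inj₂ i) = end I i

Sharp : ∀ {m} → IntervalSystem m → Set
Sharp I = Injective _≡_ _≡_ (extreme I)

ImageIs : ∀ {m m'} → (Fin (2 * m) → Fin (2 * m')) →
          IntervalSystem m → Fin m → IntervalSystem m' → Fin m' → Set
ImageIs f I i J j = ∀ w → (w ∈I (J , j)) ⇔ (∃ λ v → (v ∈I (I , i)) × (f v ≡ w))

SameImage : ∀ {m m'} → (Fin (2 * m) → Fin (2 * m')) → (Fin (2 * m) → Fin (2 * m')) →
            IntervalSystem m → Fin m → Set
SameImage f g I i = ∀ w → (∃ λ v → (v ∈I (I , i)) × (f v ≡ w)) ⇔ (∃ λ v → (v ∈I (I , i)) × (g v ≡ w))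

IsHypIso : ∀ {m m'} → IntervalSystem m → IntervalSystem m' → Fin (2 * m) ↔ Fin (2 * m') → Set
IsHypIso I J ψ =
  (∀ i → ∃ λ j → ImageIs (Inverse.to ψ) I i J j) ×
  (∀ j → ∃ λ i → ImageIs (Inverse.to ψ) I i J j)

Isomorphic : ∀ {m m'} → IntervalSystem m → IntervalSystem m' → Set
Isomorphic I J = ∃ λ ψ → IsHypIso I J ψ

MapsExtremes : ∀ {m m'} → (Fin (2 * m) → Fin (2 * m')) →
               IntervalSystem m → Fin m → IntervalSystem m' → Fin m' → Set
MapsExtremes f I i J j =
  ((f (start I i) ≡ start J j) ⊎ (f (start I i) ≡ end J j)) ×
  ((f (end I i) ≡ start J j) ⊎ (f (end I i) ≡ end J j))

module Submission where

-- Call two vertices twins if they lie in exactly the same intervals.  A vertex map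
-- that replaces every image by a twin has the same interval images as the original,
-- so it suffices to show that ψ sends the two extreme points of each interval D to
-- twins of the two extreme points of σ D (σ the induced bijection of intervals), and
-- then to build ψ' by sending extreme points to extreme points accordingly.
--
-- The heart of the proof (module Alignment) shows that the preimage of the start of
-- σ D is a twin of the start or of the end of D.  Sharpness makes every vertex the
-- extreme point of a unique interval C; if C ≠ D, comparing the positions of the
-- intervals C, D and of their images pins the vertex down as a twin of an endpoint.
-- Reversing the order of both systems turns starts into ends, which gives the same
-- statement for the end of σ D, and applying both to ψ⁻¹ as well shows that ψ maps
-- the extreme points of D onto twins of those of σ D, either in order or crossed
-- (Realignment).

open import Defs
open import Data.Nat as ℕ using (ℕ; _+_; _*_)
open import Data.Nat.Properties
  using (≤-refl; ≤-trans; <⇒≤; <⇒≱; ≰⇒>; ≤-<-trans; <-≤-trans; <-irrefl; ∸-monoʳ-≤; +-identityʳ)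
open import Data.Fin as Fin using (Fin; zero; suc; _≤_; _<_; opposite; splitAt; join; _≟_)
open import Data.Fin.Properties
  using (≤∧≢⇒<; ≤-antisym; opposite-prop; opposite-involutive; any?; injective⇒≤; join-splitAt)
open import Data.Sum as Sum using (_⊎_; inj₁; inj₂; [_,_]′; reduce; swap)
open import Data.Sum.Properties using (inj₁-injective; inj₂-injective; swap-involutive)
open import Data.Sum.Function.Propositional using (_⊎-↔_)
open import Data.Product using (_×_; _,_; ∃; proj₁; proj₂; map₂)
open import Data.Bool using (Bool; true; false; if_then_else_)
open import Data.Empty using (⊥-elim)
open import Relation.Nullary using (¬_; yes; no)
open import Relation.Nullary.Decidable using (_×-dec_; decidable-stable)
open import Relation.Binary.PropositionalEquality
open import Function using (_∘_)
open import Function.Bundles using (_↔_; Inverse; _⇔_; Equivalence; mk⇔; mk↔ₛ′)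
open import Function.Definitions using (Injective)
open import Function.Construct.Identity using (⇔-id)
open import Function.Construct.Symmetry using (⇔-sym; ↔-sym)
open import Function.Construct.Composition using (_⇔-∘_; _↔-∘_)

private
  variable
    m m' n : ℕ

module _ (I : IntervalSystem m) {k : Fin m} {v : Fin (2 * m)} where

  left-of : ¬ v ∈I (I , k) → v ≤ end I k → v < start I k
  left-of v∉k v≤t = ≰⇒> (λ s≤v → v∉k (s≤v , v≤t))

  right-of : ¬ v ∈I (I , k) → start I k ≤ v → end I k < v
  right-of v∉k s≤v = ≰⇒> (λ v≤t → v∉k (s≤v , v≤t))

  missing⇒≢ : ∀ {j} → v ∈I (I , j) → ¬ v ∈I (I , k) → k ≢ j
  missing⇒≢ v∈j v∉k refl = v∉k v∈j

  ∈-stable : ¬ ¬ v ∈I (I , k) → v ∈I (I , k)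
  ∈-stable = decidable-stable ((start I k Fin.≤? v) ×-dec (v Fin.≤? end I k))

start∈ : (I : IntervalSystem m) (k : Fin m) → start I k ∈I (I , k)
start∈ I k = ≤-refl , start≤end I k

end∈ : (I : IntervalSystem m) (k : Fin m) → end I k ∈I (I , k)
end∈ I k = start≤end I k , ≤-refl

module _ {I : IntervalSystem m} (sharp : Sharp I) where

  start-injective : ∀ {j k} → start I j ≡ start I k → j ≡ k
  start-injective {j} {k} = inj₁-injective ∘ sharp {inj₁ j} {inj₁ k}

  end-injective : ∀ {j k} → end I j ≡ end I k → j ≡ k
  end-injective {j} {k} = inj₂-injective ∘ sharp {inj₂ j} {inj₂ k}

  start≢end : ∀ {j k} → start I j ≢ end I k
  start≢end {j} {k} e with sharp {inj₁ j} {inj₂ k} e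
  ... | ()

  start-inside : ∀ {j k} → j ≢ k → start I k ∈I (I , j) → start I j < start I k
  start-inside j≢k k∈j = ≤∧≢⇒< (proj₁ k∈j) (j≢k ∘ start-injective)

  end-inside : ∀ {j k} → j ≢ k → end I k ∈I (I , j) → end I k < end I j
  end-inside j≢k k∈j = ≤∧≢⇒< (proj₂ k∈j) (j≢k ∘ sym ∘ end-injective)

  same-members : ∀ {j k} → (∀ v → v ∈I (I , j) ⇔ v ∈I (I , k)) → j ≡ k
  same-members {j} {k} j≈k = start-injective (≤-antisym
    (proj₁ (Equivalence.from (j≈k (start I k)) (start∈ I k)))
    (proj₁ (Equivalence.to (j≈k (start I j)) (start∈ I j))))

  -- the 2m extreme points are distinct, so they exhaust the 2m vertices:
  -- a missed vertex v together with them would give 2m+1 distinct vertices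
  extreme-surjective : ∀ v → ∃ λ x → extreme I x ≡ v
  extreme-surjective v with any? (λ k → extreme I (splitAt m k) ≟ v)
  ... | yes (k , e) = splitAt m k , e
  ... | no missed   =
    ⊥-elim (<-irrefl refl (subst (ℕ.suc (m + m) ℕ.≤_) 2m≡m+m (injective⇒≤ list-injective)))
    where
    2m≡m+m : 2 * m ≡ m + m
    2m≡m+m = cong (m +_) (+-identityʳ m)

    list : Fin (ℕ.suc (m + m)) → Fin (2 * m)
    list zero    = v
    list (suc k) = extreme I (splitAt m k)

    splitAt-injective : ∀ {k l} → splitAt m k ≡ splitAt m l → k ≡ l
    splitAt-injective {k} {l} e =
      trans (sym (join-splitAt m m k)) (trans (cong (join m m) e) (join-splitAt m m l))

    list-injective : Injective _≡_ _≡_ list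
    list-injective {zero}  {zero}  _ = refl
    list-injective {zero}  {suc l} e = ⊥-elim (missed (l , sym e))
    list-injective {suc k} {zero}  e = ⊥-elim (missed (k , e))
    list-injective {suc k} {suc l} e = cong suc (splitAt-injective (sharp e))

  extremes : (Fin m ⊎ Fin m) ↔ Fin (2 * m)
  extremes = mk↔ₛ′ (extreme I) (proj₁ ∘ extreme-surjective) (proj₂ ∘ extreme-surjective)
                   (λ x → sharp (proj₂ (extreme-surjective (extreme I x))))

-- Twins: vertices lying in exactly the same intervals

Twin : IntervalSystem m → Fin (2 * m) → Fin (2 * m) → Set
Twin I u v = ∀ k → u ∈I (I , k) ⇔ v ∈I (I , k)

EndpointTwin : (I : IntervalSystem m) → Fin m → Fin (2 * m) → Set
EndpointTwin I k u = Twin I u (start I k) ⊎ Twin I u (end I k)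

module _ {I : IntervalSystem m} where

  twin-refl : ∀ {u} → Twin I u u
  twin-refl _ = ⇔-id _

  twin-sym : ∀ {u v} → Twin I u v → Twin I v u
  twin-sym uv k = ⇔-sym (uv k)

  twin-trans : ∀ {u v w} → Twin I u v → Twin I v w → Twin I u w
  twin-trans uv vw k = vw k ⇔-∘ uv k

  twin→ : ∀ {u v k} → Twin I u v → u ∈I (I , k) → v ∈I (I , k)
  twin→ uv = Equivalence.to (uv _)

  twin← : ∀ {u v k} → Twin I u v → v ∈I (I , k) → u ∈I (I , k)
  twin← uv = Equivalence.from (uv _)

  match-endpoints : ∀ {a b S T} →
    Twin I S a ⊎ Twin I S b → Twin I T a ⊎ Twin I T b →
    Twin I a S ⊎ Twin I a T → Twin I b S ⊎ Twin I b T →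
    (Twin I a S × Twin I b T) ⊎ (Twin I a T × Twin I b S)
  match-endpoints _  _  (inj₁ aS) (inj₂ bT) = inj₁ (aS , bT)
  match-endpoints _  _  (inj₂ aT) (inj₁ bS) = inj₂ (aT , bS)
  match-endpoints _  hT (inj₁ aS) (inj₁ bS) = inj₁ (aS , twin-trans bS (twin-sym TS))
    where TS = [ (λ Ta → twin-trans Ta aS) , (λ Tb → twin-trans Tb bS) ]′ hT
  match-endpoints hS _  (inj₂ aT) (inj₂ bT) = inj₁ (twin-trans aT (twin-sym ST) , bT)
    where ST = [ (λ Sa → twin-trans Sa aT) , (λ Sb → twin-trans Sb bT) ]′ hS

-- Reversing the order of the vertices

opposite-antitone : {i j : Fin n} → i ≤ j → opposite j ≤ opposite i
opposite-antitone {n} {i} {j} i≤j =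
  subst₂ ℕ._≤_ (sym (opposite-prop j)) (sym (opposite-prop i)) (∸-monoʳ-≤ n (ℕ.s≤s i≤j))

-- opposite is an order-reversing involution, hence adjoint to itself
opposite-adjointʳ : {i j : Fin n} → i ≤ opposite j → j ≤ opposite i
opposite-adjointʳ {j = j} i≤j′ = subst (_≤ _) (opposite-involutive j) (opposite-antitone i≤j′)

opposite-adjointˡ : {i j : Fin n} → opposite i ≤ j → opposite j ≤ i
opposite-adjointˡ {i = i} i′≤j = subst (_ ≤_) (opposite-involutive i) (opposite-antitone i′≤j)

opposite↔ : Fin n ↔ Fin n
opposite↔ = mk↔ₛ′ opposite opposite opposite-involutive opposite-involutive

reverse : IntervalSystem m → IntervalSystem m
reverse I = record
  { start     = opposite ∘ end I
  ; end       = opposite ∘ start I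
  ; start≤end = opposite-antitone ∘ start≤end I
  }

module _ {I : IntervalSystem m} where

  ∈-reverse : ∀ {k v} → v ∈I (reverse I , k) ⇔ opposite v ∈I (I , k)
  ∈-reverse = mk⇔ (λ (t′≤v , v≤s′) → opposite-adjointʳ v≤s′ , opposite-adjointˡ t′≤v)
                  (λ (s≤v′ , v′≤t) → opposite-adjointˡ v′≤t , opposite-adjointʳ s≤v′)

  reverse-sharp : Sharp I → Sharp (reverse I)
  reverse-sharp sharp {x} {y} e =
    trans (sym (swap-involutive x)) (trans (cong swap (sharp same-extreme)) (swap-involutive y))
    where
    mirror : ∀ x → extreme (reverse I) x ≡ opposite (extreme I (swap x))
    mirror (inj₁ _) = refl
    mirror (inj₂ _) = refl
    opposite-injective : ∀ {u v : Fin (2 * m)} → opposite u ≡ opposite v → u ≡ v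
    opposite-injective {u} {v} e =
      trans (sym (opposite-involutive u)) (trans (cong opposite e) (opposite-involutive v))
    same-extreme : extreme I (swap x) ≡ extreme I (swap y)
    same-extreme = opposite-injective (trans (sym (mirror x)) (trans e (mirror y)))

  twin-reverse : ∀ {u v} → Twin (reverse I) (opposite u) (opposite v) → Twin I u v
  twin-reverse {u} {v} uv k =
    subst₂ (λ x y → x ∈I (I , k) ⇔ y ∈I (I , k)) (opposite-involutive u) (opposite-involutive v)
           (∈-reverse ⇔-∘ (uv k ⇔-∘ ⇔-sym ∈-reverse))

-- Isomorphisms of interval systems, with the bijection of intervals made explicit

record IntervalIso (I : IntervalSystem m) (J : IntervalSystem m') : Set where
  field
    vertexMap   : Fin (2 * m) ↔ Fin (2 * m')
    intervalMap : Fin m ↔ Fin m'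
    preserves   : ∀ k v → v ∈I (I , k) ⇔
                          Inverse.to vertexMap v ∈I (J , Inverse.to intervalMap k)

module IsoFacts {I : IntervalSystem m} {J : IntervalSystem m'} (R : IntervalIso I J) where
  open IntervalIso R public

  φ : Fin (2 * m) → Fin (2 * m')
  φ = Inverse.to vertexMap

  φ⁻ : Fin (2 * m') → Fin (2 * m)
  φ⁻ = Inverse.from vertexMap

  φφ⁻ : ∀ w → φ (φ⁻ w) ≡ w
  φφ⁻ = Inverse.strictlyInverseˡ vertexMap

  σ : Fin m → Fin m'
  σ = Inverse.to intervalMap

  σ⁻ : Fin m' → Fin m
  σ⁻ = Inverse.from intervalMap

  σσ⁻ : ∀ j → σ (σ⁻ j) ≡ j
  σσ⁻ = Inverse.strictlyInverseˡ intervalMap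

  σ⁻σ : ∀ k → σ⁻ (σ k) ≡ k
  σ⁻σ = Inverse.strictlyInverseʳ intervalMap

  σ-injective : ∀ {j k} → σ j ≡ σ k → j ≡ k
  σ-injective {j} {k} e = trans (sym (σ⁻σ j)) (trans (cong σ⁻ e) (σ⁻σ k))

  memF : ∀ k {v} → v ∈I (I , k) → φ v ∈I (J , σ k)
  memF k = Equivalence.to (preserves k _)

  memB : ∀ k {v} → φ v ∈I (J , σ k) → v ∈I (I , k)
  memB k = Equivalence.from (preserves k _)

  preimage-∈ : ∀ k w → φ⁻ w ∈I (I , k) ⇔ w ∈I (J , σ k)
  preimage-∈ k w = subst (λ x → φ⁻ w ∈I (I , k) ⇔ x ∈I (J , σ k)) (φφ⁻ w) (preserves k (φ⁻ w))

  preF : ∀ k {w} → φ⁻ w ∈I (I , k) → w ∈I (J , σ k)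
  preF k = Equivalence.to (preimage-∈ k _)

  preB : ∀ k {w} → w ∈I (J , σ k) → φ⁻ w ∈I (I , k)
  preB k = Equivalence.from (preimage-∈ k _)

  twin-image : ∀ {u v} → Twin I u v → Twin J (φ u) (φ v)
  twin-image {u} {v} uv j =
    subst (λ j′ → φ u ∈I (J , j′) ⇔ φ v ∈I (J , j′)) (σσ⁻ j)
          (preserves (σ⁻ j) v ⇔-∘ (uv (σ⁻ j) ⇔-∘ ⇔-sym (preserves (σ⁻ j) u)))

  endpointTwin-image : ∀ {w D} → EndpointTwin I D (φ⁻ w) →
                       Twin J w (φ (start I D)) ⊎ Twin J w (φ (end I D))
  endpointTwin-image = Sum.map image image
    where
    image : ∀ {w v} → Twin I (φ⁻ w) v → Twin J w (φ v)
    image {w} {v} = subst (λ x → Twin J x (φ v)) (φφ⁻ w) ∘ twin-image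

module _ {I : IntervalSystem m} {J : IntervalSystem m'} where

  inverseIso : IntervalIso I J → IntervalIso J I
  inverseIso R = record
    { vertexMap   = ↔-sym vertexMap
    ; intervalMap = ↔-sym intervalMap
    ; preserves   = λ j w → subst (λ j′ → w ∈I (J , j′) ⇔ φ⁻ w ∈I (I , σ⁻ j)) (σσ⁻ j)
                                  (⇔-sym (preimage-∈ (σ⁻ j) w))
    }
    where open IsoFacts R

  reverseIso : IntervalIso I J → IntervalIso (reverse I) (reverse J)
  reverseIso R = record
    { vertexMap   = opposite↔ ↔-∘ (vertexMap ↔-∘ opposite↔)
    ; intervalMap = intervalMap
    ; preserves   = λ k v →
        ⇔-sym (∈-reverse {I = J})
        ⇔-∘ (subst (λ x → opposite v ∈I (I , k) ⇔ x ∈I (J , σ k))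
                   (sym (opposite-involutive (φ (opposite v)))) (preserves k (opposite v))
        ⇔-∘ ∈-reverse {I = I})
    }
    where open IsoFacts R

-- The preimage of the start of σ D is a twin of an extreme point of D.
-- Notation: s, t for starts and ends in I; S k, T k for the start and end of σ k in J.

module Alignment {I : IntervalSystem m} {J : IntervalSystem m'}
                 (sharpI : Sharp I) (sharpJ : Sharp J) (R : IntervalIso I J) where
  open IsoFacts R

  private
    s t : Fin m → Fin (2 * m)
    s = start I
    t = end I

    S T : Fin m → Fin (2 * m')
    S k = start J (σ k)
    T k = end J (σ k)

    φs∈ : ∀ k → φ (s k) ∈I (J , σ k)
    φs∈ k = memF k (start∈ I k)

    φt∈ : ∀ k → φ (t k) ∈I (J , σ k)
    φt∈ k = memF k (end∈ I k)

    preS∈ : ∀ k → φ⁻ (S k) ∈I (I , k)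
    preS∈ k = preB k (start∈ J (σ k))

    preT∈ : ∀ k → φ⁻ (T k) ∈I (I , k)
    preT∈ k = preB k (end∈ J (σ k))

    hit-∈ : ∀ {p w} → φ p ≡ w → ∀ E → p ∈I (I , E) ⇔ w ∈I (J , σ E)
    hit-∈ {p} hit E = subst (λ x → p ∈I (I , E) ⇔ x ∈I (J , σ E)) hit (preserves E p)

    S-inside : ∀ {C D} → C ≢ D → S D ∈I (J , σ C) → S C < S D
    S-inside C≢D = start-inside sharpJ (C≢D ∘ σ-injective)

    preS∉ : ∀ {C D} → S C < S D → ¬ φ⁻ (S C) ∈I (I , D)
    preS∉ SC<SD h = <⇒≱ SC<SD (proj₁ (preF _ h))

  -- If the end of an interval C ≠ D is sent to S D, it is a twin of s D.
  -- (C then overlaps D from the left, and so does σ C with σ D.)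
  module EndOntoStart {C D : Fin m} (C≢D : C ≢ D) (hit : φ (t C) ≡ S D) where

    tC∈D : t C ∈I (I , D)
    tC∈D = Equivalence.from (hit-∈ hit D) (start∈ J (σ D))

    sD<tC : s D < t C
    sD<tC = ≤∧≢⇒< (proj₁ tC∈D) (start≢end sharpI)

    tC<tD : t C < t D
    tC<tD = ≤∧≢⇒< (proj₂ tC∈D) (C≢D ∘ end-injective sharpI)

    SC<SD : S C < S D
    SC<SD = S-inside C≢D (Equivalence.to (hit-∈ hit C) (end∈ I C))

    -- the preimage of S C lies in C but left of D, so C starts before D
    sC<sD : s C < s D
    sC<sD = ≤-<-trans (proj₁ (preS∈ C))
                      (left-of I (preS∉ SC<SD) (≤-trans (proj₂ (preS∈ C)) (<⇒≤ tC<tD)))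

    -- t D lies right of C, so its image lies right of σ C
    TC<φtD : T C < φ (t D)
    TC<φtD = right-of J (λ h → <⇒≱ tC<tD (proj₂ (memB C h)))
                        (≤-trans (<⇒≤ SC<SD) (proj₁ (φt∈ D)))

    -- an interval E through s D but not t C contains q = φ⁻ (T D), hence so does C,
    -- which forces T D ≤ T C < φ (t D) ≤ T D
    forward : ∀ E → s D ∈I (I , E) → ¬ ¬ t C ∈I (I , E)
    forward E sD∈E tC∉E =
      <-irrefl refl (≤-<-trans (proj₂ (preF C q∈C)) (<-≤-trans TC<φtD (proj₂ (φt∈ D))))
      where
      tE<tC : t E < t C
      tE<tC = right-of I tC∉E (≤-trans (proj₁ sD∈E) (<⇒≤ sD<tC))
      sE<sD : s E < s D
      sE<sD = start-inside sharpI (missing⇒≢ I tC∈D tC∉E) sD∈E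
      SD<SE : S D < S E
      SD<SE = left-of J (tC∉E ∘ Equivalence.from (hit-∈ hit E))
                        (≤-trans (proj₁ (φs∈ D)) (proj₂ (memF E sD∈E)))
      TD<φsE : T D < φ (s E)
      TD<φsE = right-of J (λ h → <⇒≱ sE<sD (proj₁ (memB D h)))
                          (≤-trans (<⇒≤ SD<SE) (proj₁ (φs∈ E)))
      q∈E : φ⁻ (T D) ∈I (I , E)
      q∈E = preB E ( ≤-trans (proj₁ (memF E sD∈E)) (proj₂ (φs∈ D))
                   , ≤-trans (<⇒≤ TD<φsE) (proj₂ (φs∈ E)))
      q∈C : φ⁻ (T D) ∈I (I , C)
      q∈C = ≤-trans (<⇒≤ sC<sD) (proj₁ (preT∈ D)) , ≤-trans (proj₂ q∈E) (<⇒≤ tE<tC)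

    -- an interval E through t C but not s D reaches past t D (it contains d = φ⁻ (S E)),
    -- and then σ E contains φ (s D), so E contains s D after all
    backward : ∀ E → t C ∈I (I , E) → ¬ ¬ s D ∈I (I , E)
    backward E tC∈E sD∉E = sD∉E (memB E φsD∈E)
      where
      SE<SD : S E < S D
      SE<SD = S-inside (missing⇒≢ I (start∈ I D) sD∉E) (Equivalence.to (hit-∈ hit E) tC∈E)
      sD<sE : s D < s E
      sD<sE = left-of I sD∉E (≤-trans (<⇒≤ sD<tC) (proj₂ tC∈E))
      tD<d : t D < φ⁻ (S E)
      tD<d = right-of I (preS∉ SE<SD) (≤-trans (<⇒≤ sD<sE) (proj₁ (preS∈ E)))
      tD∈E : t D ∈I (I , E)
      tD∈E = ≤-trans (proj₁ tC∈E) (<⇒≤ tC<tD) , ≤-trans (<⇒≤ tD<d) (proj₂ (preS∈ E))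
      φsD∈E : φ (s D) ∈I (J , σ E)
      φsD∈E = ≤-trans (<⇒≤ SE<SD) (proj₁ (φs∈ D))
            , ≤-trans (proj₂ (memF C (<⇒≤ sC<sD , <⇒≤ sD<tC)))
                      (≤-trans (<⇒≤ TC<φtD) (proj₂ (memF E tD∈E)))

    twin : Twin I (t C) (s D)
    twin E = mk⇔ (∈-stable I ∘ backward E) (∈-stable I ∘ forward E)

  -- If the start of an interval C ≠ D is sent to S D, it is a twin of t D.
  -- (C then overlaps D from the right, while σ C overlaps σ D from the left.)
  module StartOntoStart {C D : Fin m} (C≢D : C ≢ D) (hit : φ (s C) ≡ S D) where

    sC∈D : s C ∈I (I , D)
    sC∈D = Equivalence.from (hit-∈ hit D) (start∈ J (σ D))

    sD<sC : s D < s C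
    sD<sC = ≤∧≢⇒< (proj₁ sC∈D) (C≢D ∘ sym ∘ start-injective sharpI)

    sC<tD : s C < t D
    sC<tD = ≤∧≢⇒< (proj₂ sC∈D) (start≢end sharpI)

    SC<SD : S C < S D
    SC<SD = S-inside C≢D (Equivalence.to (hit-∈ hit C) (start∈ I C))

    -- the preimage of S C lies in C but right of D, so C ends after D
    tD<tC : t D < t C
    tD<tC = <-≤-trans (right-of I (preS∉ SC<SD) (≤-trans (<⇒≤ sD<sC) (proj₁ (preS∈ C))))
                      (proj₂ (preS∈ C))

    -- s D lies left of C, yet its image lies right of σ C
    TC<φsD : T C < φ (s D)
    TC<φsD = right-of J (λ h → <⇒≱ sD<sC (proj₁ (memB C h)))
                        (≤-trans (<⇒≤ SC<SD) (proj₁ (φs∈ D)))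

    -- an interval E through t D but not s C contains q = φ⁻ (T D), hence so does C,
    -- which forces T D ≤ T C < φ (s D) ≤ T D
    forward : ∀ E → t D ∈I (I , E) → ¬ ¬ s C ∈I (I , E)
    forward E tD∈E sC∉E =
      <-irrefl refl (≤-<-trans (proj₂ (preF C q∈C)) (<-≤-trans TC<φsD (proj₂ (φs∈ D))))
      where
      sC<sE : s C < s E
      sC<sE = left-of I sC∉E (≤-trans (<⇒≤ sC<tD) (proj₂ tD∈E))
      tD<tE : t D < t E
      tD<tE = end-inside sharpI (missing⇒≢ I sC∈D sC∉E) tD∈E
      SD<SE : S D < S E
      SD<SE = left-of J (sC∉E ∘ Equivalence.from (hit-∈ hit E))
                        (≤-trans (proj₁ (φt∈ D)) (proj₂ (memF E tD∈E)))
      TD<φtE : T D < φ (t E)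
      TD<φtE = right-of J (λ h → <⇒≱ tD<tE (proj₂ (memB D h)))
                          (≤-trans (<⇒≤ SD<SE) (proj₁ (φt∈ E)))
      q∈E : φ⁻ (T D) ∈I (I , E)
      q∈E = preB E ( ≤-trans (proj₁ (memF E tD∈E)) (proj₂ (φt∈ D))
                   , ≤-trans (<⇒≤ TD<φtE) (proj₂ (φt∈ E)))
      q∈C : φ⁻ (T D) ∈I (I , C)
      q∈C = ≤-trans (<⇒≤ sC<sE) (proj₁ q∈E) , ≤-trans (proj₂ (preT∈ D)) (<⇒≤ tD<tC)

    -- an interval E through s C but not t D reaches before s D (it contains d = φ⁻ (S E)),
    -- and then σ E contains φ (t D), so E contains t D after all
    backward : ∀ E → s C ∈I (I , E) → ¬ ¬ t D ∈I (I , E)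
    backward E sC∈E tD∉E = tD∉E (memB E φtD∈E)
      where
      SE<SD : S E < S D
      SE<SD = S-inside (missing⇒≢ I (end∈ I D) tD∉E) (Equivalence.to (hit-∈ hit E) sC∈E)
      tE<tD : t E < t D
      tE<tD = right-of I tD∉E (≤-trans (proj₁ sC∈E) (<⇒≤ sC<tD))
      d<sD : φ⁻ (S E) < s D
      d<sD = left-of I (preS∉ SE<SD) (≤-trans (proj₂ (preS∈ E)) (<⇒≤ tE<tD))
      sD∈E : s D ∈I (I , E)
      sD∈E = ≤-trans (proj₁ (preS∈ E)) (<⇒≤ d<sD) , ≤-trans (<⇒≤ sD<sC) (proj₂ sC∈E)
      φtD∈E : φ (t D) ∈I (J , σ E)
      φtD∈E = ≤-trans (<⇒≤ SE<SD) (proj₁ (φt∈ D))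
            , ≤-trans (proj₂ (memF C (<⇒≤ sC<tD , <⇒≤ tD<tC)))
                      (≤-trans (<⇒≤ TC<φsD) (proj₂ (memF E sD∈E)))

    twin : Twin I (s C) (t D)
    twin E = mk⇔ (∈-stable I ∘ backward E) (∈-stable I ∘ forward E)

  -- φ⁻ (S D) is the extreme point of some interval C; either C = D or one of the cases above
  preimage-start : ∀ D → EndpointTwin I D (φ⁻ (S D))
  preimage-start D with extreme-surjective sharpI (φ⁻ (S D))
  ... | inj₁ C , sC≡p with C ≟ D
  ...   | yes refl = inj₁ (subst (λ u → Twin I u (s D)) sC≡p (twin-refl {I = I}))
  ...   | no C≢D   = inj₂ (subst (λ u → Twin I u (t D)) sC≡p
                            (StartOntoStart.twin C≢D (trans (cong φ sC≡p) (φφ⁻ (S D)))))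
  preimage-start D | inj₂ C , tC≡p with C ≟ D
  ...   | yes refl = inj₂ (subst (λ u → Twin I u (t D)) tC≡p (twin-refl {I = I}))
  ...   | no C≢D   = inj₁ (subst (λ u → Twin I u (s D)) tC≡p
                            (EndOntoStart.twin C≢D (trans (cong φ tC≡p) (φφ⁻ (S D)))))

-- mirroring both systems exchanges starts and ends, so the same holds for the end of σ D
preimage-end : {I : IntervalSystem m} {J : IntervalSystem m'} → Sharp I → Sharp J →
               (R : IntervalIso I J) → let open IsoFacts R in
               ∀ D → EndpointTwin I D (φ⁻ (end J (σ D)))
preimage-end {I = I} {J} sharpI sharpJ R D =
  subst (EndpointTwin I D ∘ φ⁻) (opposite-involutive (end J (σ D)))
        (Sum.swap (Sum.map (twin-reverse {I = I}) (twin-reverse {I = I})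
          (Alignment.preimage-start (reverse-sharp sharpI) (reverse-sharp sharpJ)
                                    (reverseIso R) D)))
  where open IsoFacts R

module _ {I : IntervalSystem m} {J : IntervalSystem m'} where

  same-image : ∀ {f g : Fin (2 * m) → Fin (2 * m')} {i j} →
               ImageIs g I i J j → ImageIs f I i J j → SameImage {m} {m'} g f I i
  same-image img imf w = imf w ⇔-∘ ⇔-sym (img w)

  module _ (ψ : Fin (2 * m) ↔ Fin (2 * m')) where

    image-∈ : ∀ {i j} → ImageIs (Inverse.to ψ) I i J j →
              ∀ v → v ∈I (I , i) ⇔ Inverse.to ψ v ∈I (J , j)
    image-∈ {i} im v = mk⇔ (λ v∈i → Equivalence.from (im (Inverse.to ψ v)) (v , v∈i , refl)) back
      where
      back : Inverse.to ψ v ∈I (J , _) → v ∈I (I , i)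
      back h with Equivalence.to (im (Inverse.to ψ v)) h
      ... | v′ , v′∈i , e = subst (_∈I (I , i)) (injective e) v′∈i
        where
        injective : ∀ {x y} → Inverse.to ψ x ≡ Inverse.to ψ y → x ≡ y
        injective {x} {y} e = trans (sym (Inverse.strictlyInverseʳ ψ x))
                                    (trans (cong (Inverse.from ψ) e) (Inverse.strictlyInverseʳ ψ y))

    image-target-unique : Sharp J → ∀ {i j k} →
      ImageIs (Inverse.to ψ) I i J j → ImageIs (Inverse.to ψ) I i J k → j ≡ k
    image-target-unique sharpJ imj imk = same-members sharpJ (λ w → ⇔-sym (imk w) ⇔-∘ imj w)

    image-source-unique : Sharp I → ∀ {i j k} →
      ImageIs (Inverse.to ψ) I i J j → ImageIs (Inverse.to ψ) I k J j → i ≡ k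
    image-source-unique sharpI imi imk =
      same-members sharpI (λ v → ⇔-sym (image-∈ imk v) ⇔-∘ image-∈ imi v)

    image-twin : ∀ {i j} (ψ′ : Fin (2 * m) ↔ Fin (2 * m')) →
                 (∀ v → Twin J (Inverse.to ψ′ v) (Inverse.to ψ v)) →
                 ImageIs (Inverse.to ψ) I i J j → ImageIs (Inverse.to ψ′) I i J j
    image-twin {i} {j} ψ′ twins im w = mk⇔ forth back
      where
      forth : w ∈I (J , j) → ∃ λ v → v ∈I (I , i) × Inverse.to ψ′ v ≡ w
      forth h = v , Equivalence.from (image-∈ im v) (twin→ {I = J} (twins v) ψ′v∈j)
                  , Inverse.strictlyInverseˡ ψ′ w
        where
        v = Inverse.from ψ′ w
        ψ′v∈j : Inverse.to ψ′ v ∈I (J , j)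
        ψ′v∈j = subst (_∈I (J , j)) (sym (Inverse.strictlyInverseˡ ψ′ w)) h
      back : (∃ λ v → v ∈I (I , i) × Inverse.to ψ′ v ≡ w) → w ∈I (J , j)
      back (v , v∈i , e) =
        subst (_∈I (J , j)) e (twin← {I = J} (twins v) (Equivalence.to (image-∈ im v) v∈i))

    fromHypIso : Sharp I → Sharp J → IsHypIso I J ψ → IntervalIso I J
    fromHypIso sharpI sharpJ (forth , back) = record
      { vertexMap   = ψ
      ; intervalMap = mk↔ₛ′ (proj₁ ∘ forth) (proj₁ ∘ back)
          (λ j → image-target-unique sharpJ (proj₂ (forth (proj₁ (back j)))) (proj₂ (back j)))
          (λ i → image-source-unique sharpI (proj₂ (back (proj₁ (forth i)))) (proj₂ (forth i)))
      ; preserves   = λ k → image-∈ (proj₂ (forth k))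
      }

flipEnds : (Fin m → Bool) → Fin m ⊎ Fin m → Fin m ⊎ Fin m
flipEnds b (inj₁ i) = if b i then inj₂ i else inj₁ i
flipEnds b (inj₂ i) = if b i then inj₁ i else inj₂ i

flipEnds-involutive : ∀ b (x : Fin m ⊎ Fin m) → flipEnds b (flipEnds b x) ≡ x
flipEnds-involutive b (inj₁ i) with b i in eq
... | true  rewrite eq = refl
... | false rewrite eq = refl
flipEnds-involutive b (inj₂ i) with b i in eq
... | true  rewrite eq = refl
... | false rewrite eq = refl

flipEnds↔ : (Fin m → Bool) → (Fin m ⊎ Fin m) ↔ (Fin m ⊎ Fin m)
flipEnds↔ b = mk↔ₛ′ (flipEnds b) (flipEnds b) (flipEnds-involutive b) (flipEnds-involutive b)

EndOf : IntervalSystem m → Fin m → Fin (2 * m) → Set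
EndOf J k w = (w ≡ start J k) ⊎ (w ≡ end J k)

module Realignment {I : IntervalSystem m} {J : IntervalSystem m'}
                   (sharpI : Sharp I) (sharpJ : Sharp J) (R : IntervalIso I J) where
  open IsoFacts R

  private
    a b : Fin m → Fin (2 * m')
    a i = φ (start I i)
    b i = φ (end I i)

  Aligned Crossed : Fin m → Set
  Aligned i = Twin J (a i) (start J (σ i)) × Twin J (b i) (end J (σ i))
  Crossed i = Twin J (a i) (end J (σ i)) × Twin J (b i) (start J (σ i))

  -- combine the alignment lemma for φ (extreme points of σ i are twins of a i or b i)
  -- with the one for φ⁻¹ (a i and b i are twins of extreme points of σ i)
  orientation : ∀ i → Aligned i ⊎ Crossed i
  orientation i = match-endpoints {I = J}
    (endpointTwin-image (Alignment.preimage-start sharpI sharpJ R i))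
    (endpointTwin-image (preimage-end sharpI sharpJ R i))
    (subst (λ k → EndpointTwin J (σ i) (φ (start I k))) (σ⁻σ i)
           (Alignment.preimage-start sharpJ sharpI (inverseIso R) (σ i)))
    (subst (λ k → EndpointTwin J (σ i) (φ (end I k))) (σ⁻σ i)
           (preimage-end sharpJ sharpI (inverseIso R) (σ i)))

  relabel : (Fin m ⊎ Fin m) ↔ (Fin m' ⊎ Fin m')
  relabel = (intervalMap ⊎-↔ intervalMap) ↔-∘ flipEnds↔ crossed
    where
    crossed : Fin m → Bool
    crossed i = [ (λ _ → false) , (λ _ → true) ]′ (orientation i)

  ψ′ : Fin (2 * m) ↔ Fin (2 * m')
  ψ′ = extremes sharpJ ↔-∘ (relabel ↔-∘ ↔-sym (extremes sharpI))

  twin-relabelled : ∀ x → Twin J (extreme J (Inverse.to relabel x)) (φ (extreme I x))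
  twin-relabelled (inj₁ i) with orientation i
  ... | inj₁ (aS , _) = twin-sym {I = J} aS
  ... | inj₂ (aT , _) = twin-sym {I = J} aT
  twin-relabelled (inj₂ i) with orientation i
  ... | inj₁ (_ , bT) = twin-sym {I = J} bT
  ... | inj₂ (_ , bS) = twin-sym {I = J} bS

  relabel-endpoint : ∀ x → EndOf J (σ (reduce x)) (extreme J (Inverse.to relabel x))
  relabel-endpoint (inj₁ i) with orientation i
  ... | inj₁ _ = inj₁ refl
  ... | inj₂ _ = inj₂ refl
  relabel-endpoint (inj₂ i) with orientation i
  ... | inj₁ _ = inj₂ refl
  ... | inj₂ _ = inj₁ refl

  twin-corrected : ∀ v → Twin J (Inverse.to ψ′ v) (φ v)
  twin-corrected v = subst (λ u → Twin J (Inverse.to ψ′ v) (φ u))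
                           (Inverse.strictlyInverseˡ (extremes sharpI) v)
                           (twin-relabelled (Inverse.from (extremes sharpI) v))

  maps-extremes : ∀ i → MapsExtremes (Inverse.to ψ′) I i J (σ i)
  maps-extremes i = endpoint (inj₁ i) , endpoint (inj₂ i)
    where
    endpoint : ∀ x → EndOf J (σ (reduce x)) (Inverse.to ψ′ (extreme I x))
    endpoint x = subst (λ y → EndOf J (σ (reduce x)) (extreme J (Inverse.to relabel y)))
                       (sym (Inverse.strictlyInverseʳ (extremes sharpI) x)) (relabel-endpoint x)

lemma10 : ∀ {m m'} (I : IntervalSystem m) (J : IntervalSystem m') →
          Sharp I → Sharp J → Isomorphic I J →
          (ψ : Fin (2 * m) ↔ Fin (2 * m')) → IsHypIso I J ψ →
          ∃ λ (ψ' : Fin (2 * m) ↔ Fin (2 * m')) →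
            IsHypIso I J ψ' ×
            (∀ i → SameImage {m} {m'} (Inverse.to ψ') (Inverse.to ψ) I i) ×
            (∀ i j → ImageIs (Inverse.to ψ) I i J j → MapsExtremes (Inverse.to ψ') I i J j)
lemma10 {m} {m'} I J sharpI sharpJ _ ψ hi@(forth , back) = ψ′ , hyp-iso , same , realigned
  where
  open Realignment sharpI sharpJ (fromHypIso ψ sharpI sharpJ hi)

  -- ψ′ differs from ψ only by twins, so it has the same interval images
  correct : ∀ {i j} → ImageIs (Inverse.to ψ) I i J j → ImageIs (Inverse.to ψ′) I i J j
  correct = image-twin {I = I} {J = J} ψ ψ′ twin-corrected

  hyp-iso : IsHypIso I J ψ′
  hyp-iso = (λ i → map₂ correct (forth i)) , (λ j → map₂ correct (back j))

  same : ∀ i → SameImage {m} {m'} (Inverse.to ψ′) (Inverse.to ψ) I i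
  same i = same-image {I = I} {J = J} (correct (proj₂ (forth i))) (proj₂ (forth i))

  -- the interval j in the hypothesis is necessarily σ i
  realigned : ∀ i j → ImageIs (Inverse.to ψ) I i J j → MapsExtremes (Inverse.to ψ′) I i J j
  realigned i j im = subst (MapsExtremes (Inverse.to ψ′) I i J)
                           (image-target-unique {I = I} ψ sharpJ (proj₂ (forth i)) im)
                           (maps-extremes i)
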